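{- Let $P$ be a decreasing tableau, $(r,c)$ a removable cell of $P$, $\alpha\in\{0,1\}$, and $\Psi(P,(r,c),\alpha)=(P',m)$. Then $\mathrm{row}(P)\equiv_H \mathrm{row}(P')\,m$.
   Context: Tableaux use English notation; cell $(i,j)$ is in row $i$, column $j$. A decreasing tableau is a filling of the diagram of a partition by positive integers strictly decreasing from left to right along rows and from top to bottom along columns. A cell is removable if it is the last cell of its row and the bottom cell of its column. $P_{>r}$ denotes the tableau obtained by deleting the first $r$ rows of $P$ (rows renumbered from 1). The row word $\mathrm{row}(P)$ is $\cdots u^{(2)}u^{(1)}$, where $u^{(j)}$ is row $j$ of $P$ read left to right. Hecke equivalence $\equiv_H$ on words in $\mathbb{Z}_{>0}$ is the congruence generated by $jj\equiv_H j$, $j(j+1)j\equiv_H (j+1)j(j+1)$, and $jk\equiv_H kj$ for $|j-k|\ge 2$. A value $x$ is $P$-ejectable if $x$ occurs in the first row of $P$ and either $x-1$ does not occur in the first row, or $x-1$ occurs in the first row and $x-1$ is $P_{>1}$-ejectable (nothing is ejectable in the empty tableau). Bumping path of a removable cell $(r,c)$ of $P$: $m_r$ is the entry at $(r,c)$, and for $i=r-1,\dots,1$, $m_i$ is the smallest entry of row $i$ with $m_i>m_{i+1}$. Reverse insertion $\Psi(P,(r,c),\alpha)=(P',m)$: compute the bumping path $m_r<\dots<m_1$; set $m:=m_1$, $P':=P$. If $\alpha=1$, delete cell $(r,c)$ from $P'$, set $\alpha_r=1$, and process rows $i=r-1,\dots,1$. If $\alpha=0$, set $m_{r+1}=0$,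 $\alpha_{r+1}=0$, and process rows $i=r,\dots,1$. Processing row $i$ with $R$ the set of entries of row $i$ of $P$: (D) if $m_i-1\in R$, leave row $i$, $\alpha_i=\alpha_{i+1}$; (DR) else if $\alpha_{i+1}=1$ and $m_{i+1}\notin R$, replace $m_i$ in row $i$ of $P'$ by $m_{i+1}$, $\alpha_i=1$; otherwise let $x$ be the smallest $P'_{>i}$-ejectable value (current $P'$) with $m_{i+1}<x<m_i$: (IR) if $x$ exists replace $m_i$ by $x$, $\alpha_i=1$; (NR) else leave row $i$, $\alpha_i=0$. Output final $P'$ and $m$. -}

module Defs where

open import Data.Nat using (ℕ; zero; suc; _+_; _∸_; _≤_; _<_; _≡ᵇ_; _<ᵇ_)
open import Data.Bool using (Bool; true; false; _∧_; _∨_; not; if_then_else_)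
open import Data.List using (List; []; _∷_; _++_; length; map; concat; reverse; filter; upTo; take)
open import Data.List.Relation.Unary.All using (All)
open import Data.List.Relation.Unary.Linked using (Linked)
open import Data.Maybe using (Maybe; just; nothing)
open import Data.Product using (_×_; _,_; proj₁; proj₂)
open import Data.Unit using (⊤)
open import Data.Empty using (⊥)
open import Relation.Binary.PropositionalEquality using (_≡_)

-- Tableaux: a tableau is the list of its rows (row 1 first), each row
-- listed left to right.

Tab : Set
Tab = List (List ℕ)

-- `Below u w` : row w lies directly below row u in a partition shape
-- (length w ≤ length u) and columns strictly decrease downward.
Below : List ℕ → List ℕ → Set
Below _       []      = ⊤
Below []      (_ ∷ _) = ⊥
Below (a ∷ u) (b ∷ w) = b < a × Below u w

NonEmpty : List ℕ → Set
NonEmpty []      = ⊥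
NonEmpty (_ ∷ _) = ⊤

_>_ : ℕ → ℕ → Set
a > b = b < a

DecreasingTableau : Tab → Set
DecreasingTableau P =
  All NonEmpty P × All (All (0 <_)) P × All (Linked _>_) P × Linked Below P

-- 1-indexed row access (row 0 / rows past the end are empty)
rowAt : Tab → ℕ → List ℕ
rowAt []       _             = []
rowAt (u ∷ P)  zero          = []
rowAt (u ∷ P)  (suc zero)    = u
rowAt (u ∷ P)  (suc (suc i)) = rowAt P (suc i)

-- 1-indexed entry access in a list (default 0)
nth : List ℕ → ℕ → ℕ
nth []      _             = 0
nth (x ∷ u) zero          = 0
nth (x ∷ u) (suc zero)    = x
nth (x ∷ u) (suc (suc j)) = nth u (suc j)

entryAt : Tab → ℕ → ℕ → ℕ
entryAt P r c = nth (rowAt P r) c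

-- (r,c) is a removable cell of P: it is a cell, the last one of its row,
-- and the bottom one of its column.
Removable : Tab → ℕ → ℕ → Set
Removable P r c =
  1 ≤ r × r ≤ length P × 1 ≤ c × length (rowAt P r) ≡ c × length (rowAt P (suc r)) < c

-- modify row i (1-indexed)
modifyRow : ℕ → (List ℕ → List ℕ) → Tab → Tab
modifyRow _             f []      = []
modifyRow zero          f (u ∷ P) = u ∷ P
modifyRow (suc zero)    f (u ∷ P) = f u ∷ P
modifyRow (suc (suc i)) f (u ∷ P) = u ∷ modifyRow (suc i) f P

dropRows : ℕ → Tab → Tab
dropRows zero    P       = P
dropRows (suc i) []      = []
dropRows (suc i) (_ ∷ P) = dropRows i P

Word : Set
Word = List ℕ

rowWord : Tab → Word
rowWord P = concat (reverse P)

infix 4 _≡H_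
data _≡H_ : Word → Word → Set where
  H-refl  : ∀ {u} → u ≡H u
  H-sym   : ∀ {u v} → u ≡H v → v ≡H u
  H-trans : ∀ {u v w} → u ≡H v → v ≡H w → u ≡H w
  H-idem  : ∀ u v j → (u ++ j ∷ j ∷ v) ≡H (u ++ j ∷ v)
  H-braid : ∀ u v j → (u ++ j ∷ suc j ∷ j ∷ v) ≡H (u ++ suc j ∷ j ∷ suc j ∷ v)
  H-comm  : ∀ u v j k → 2 + j ≤ k → (u ++ j ∷ k ∷ v) ≡H (u ++ k ∷ j ∷ v)

memb : ℕ → List ℕ → Bool
memb x []      = false
memb x (y ∷ u) = (x ≡ᵇ y) ∨ memb x u

ejectable : Tab → ℕ → Bool
ejectable []      x = false
ejectable (u ∷ T) x = memb x u ∧ (not (memb (x ∸ 1) u) ∨ (memb (x ∸ 1) u ∧ ejectable T (x ∸ 1)))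

smallestAbove : List ℕ → ℕ → Maybe ℕ
smallestAbove []      m = nothing
smallestAbove (y ∷ u) m with smallestAbove u m
... | just z  = if m <ᵇ y then (if y <ᵇ z then just y else just z) else just z
... | nothing = if m <ᵇ y then just y else nothing

fromMaybe0 : Maybe ℕ → ℕ
fromMaybe0 (just x) = x
fromMaybe0 nothing  = 0

-- pathAux P r c k = m_{r-k}
pathAux : Tab → ℕ → ℕ → ℕ → ℕ
pathAux P r c zero    = entryAt P r c
pathAux P r c (suc k) = fromMaybe0 (smallestAbove (rowAt P (r ∸ suc k)) (pathAux P r c k))

-- m_i of the bumping path of the cell (r,c), for 1 ≤ i ≤ r
bumpPath : Tab → ℕ → ℕ → ℕ → ℕ
bumpPath P r c i = pathAux P r c (r ∸ i)

replaceIn : ℕ → ℕ → List ℕ → List ℕ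
replaceIn old new = map (λ y → if y ≡ᵇ old then new else y)

firstWith : (ℕ → Bool) → List ℕ → Maybe ℕ
firstWith p []      = nothing
firstWith p (x ∷ u) = if p x then just x else firstWith p u

-- processing row i:  P original, P' current, mi = m_i, mn = m_{i+1},
-- a = α_{i+1}; returns the new P' and α_i
processRow : Tab → Tab → ℕ → ℕ → ℕ → Bool → Tab × Bool
processRow P P' i mi mn a with memb (mi ∸ 1) (rowAt P i)
... | true  = P' , a
... | false with a ∧ not (memb mn (rowAt P i))
...   | true  = modifyRow i (replaceIn mi mn) P' , true
...   | false with firstWith (ejectable (dropRows i P'))
                     (map (λ k → suc mn + k) (upTo (mi ∸ suc mn)))
...     | just x  = modifyRow i (replaceIn mi x) P' , true
...     | nothing = P' , false

-- process rows i = n, n-1, ..., 1; mn = m_{n+1}, a = α_{n+1}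
processRows : Tab → ℕ → ℕ → ℕ → Tab → ℕ → Bool → Tab
processRows P r c zero    P' mn a = P'
processRows P r c (suc j) P' mn a =
  let mi = bumpPath P r c (suc j)
      res = processRow P P' (suc j) mi mn a
  in processRows P r c j (proj₁ res) mi (proj₂ res)

-- Ψ(P,(r,c),α) = (P', m);  α = 1 is `true`, α = 0 is `false`.
-- (Deleting cell (r,c) may leave an empty final row; this does not affect
-- row words or ejectability.)
Ψ : Tab → ℕ → ℕ → Bool → Tab × ℕ
Ψ P r c true  =
  processRows P r c (r ∸ 1) (modifyRow r (take (c ∸ 1)) P) (bumpPath P r c r) true
  , bumpPath P r c 1
Ψ P r c false =
  processRows P r c r P 0 false , bumpPath P r c 1

-- Reverse insertion walks up the rows r, r-1, …, 1, carrying the letter m_{i+1}.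
-- Let V be the row word of the original rows below row i and W that of their
-- images.  Then V ≡H W m_{i+1} while the letter is still carried (α_{i+1} = 1), and
-- V ≡H W ≡H W m_{i+1} once it has been swallowed (α_{i+1} = 0).  Each of the cases
-- D, DR, IR, NR preserves this by Hecke moves inside row i alone: rows decrease, so
-- a letter commutes past every entry at distance at least 2 and meets at most its
-- two neighbours, where a braid (D), the idempotent relation (NR), or a plain
-- exchange (DR, IR) applies.  An ejectable value is swallowed by the rows below
-- (induction along its ejection chain), which is what makes IR work.  After row 1
-- the carried letter is m = m_1.
module Submission where

open import Defs
open import Data.Bool using (Bool; true; false; _∧_; not)
open import Data.Nat using (ℕ; zero; suc; _+_; _∸_; _≤_; _<_; s≤s; z<s; s≤s⁻¹; _≡ᵇ_; _<ᵇ_; _≟_)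
open import Data.Nat.Properties
open import Data.Maybe using (Maybe; just; nothing)
open import Data.Product as Product using (∃; _×_; _,_; proj₁; proj₂)
open import Data.Sum using (_⊎_; inj₁; inj₂)
open import Data.List using (List; []; _∷_; _++_; [_]; concat; reverse; length; map; upTo; take)
open import Data.List.Properties using (++-assoc; ++-identityʳ; concat-++; unfold-reverse; length-take)
open import Data.List.Relation.Unary.All as All using (All; []; _∷_)
import Data.List.Relation.Unary.All.Properties as All
open import Data.List.Relation.Unary.AllPairs using (AllPairs; []; _∷_)
open import Data.List.Relation.Unary.AllPairs.Properties using (take⁺)
open import Data.List.Relation.Unary.Any using (here; there)
open import Data.List.Relation.Unary.Linked using (Linked; []; [-]; _∷_)
open import Data.List.Relation.Unary.Linked.Properties using (Linked⇒AllPairs)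
open import Data.List.Membership.Propositional using (_∈_; _∉_)
open import Data.List.Membership.Propositional.Properties using (∈-++⁺ˡ; ∈-++⁺ʳ; ∈-++⁻; ∈-map⁻; ∈-upTo⁻)
open import Relation.Nullary using (¬_; contradiction; proof)
open import Relation.Nullary.Reflects using (Reflects; ofʸ; ofⁿ; invert)
open import Relation.Binary.Bundles using (Setoid)
import Relation.Binary.Reasoning.Setoid
open import Relation.Binary.PropositionalEquality
  using (_≡_; _≢_; refl; sym; trans; cong; cong₂; subst; subst₂; module ≡-Reasoning)

≡H-++ˡ : ∀ p {u v} → u ≡H v → p ++ u ≡H p ++ v
≡H-++ˡ p H-refl               = H-refl
≡H-++ˡ p (H-sym h)            = H-sym (≡H-++ˡ p h)
≡H-++ˡ p (H-trans h h')       = H-trans (≡H-++ˡ p h) (≡H-++ˡ p h')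
≡H-++ˡ p (H-idem u v j)       = subst₂ _≡H_ (++-assoc p u _) (++-assoc p u _) (H-idem (p ++ u) v j)
≡H-++ˡ p (H-braid u v j)      = subst₂ _≡H_ (++-assoc p u _) (++-assoc p u _) (H-braid (p ++ u) v j)
≡H-++ˡ p (H-comm u v j k j≪k) = subst₂ _≡H_ (++-assoc p u _) (++-assoc p u _) (H-comm (p ++ u) v j k j≪k)

≡H-++ʳ : ∀ s {u v} → u ≡H v → u ++ s ≡H v ++ s
≡H-++ʳ s H-refl               = H-refl
≡H-++ʳ s (H-sym h)            = H-sym (≡H-++ʳ s h)
≡H-++ʳ s (H-trans h h')       = H-trans (≡H-++ʳ s h) (≡H-++ʳ s h')
≡H-++ʳ s (H-idem u v j)       = subst₂ _≡H_ (sym (++-assoc u _ s)) (sym (++-assoc u _ s)) (H-idem u (v ++ s) j)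
≡H-++ʳ s (H-braid u v j)      = subst₂ _≡H_ (sym (++-assoc u _ s)) (sym (++-assoc u _ s)) (H-braid u (v ++ s) j)
≡H-++ʳ s (H-comm u v j k j≪k) = subst₂ _≡H_ (sym (++-assoc u _ s)) (sym (++-assoc u _ s)) (H-comm u (v ++ s) j k j≪k)

≡H-∷ : ∀ x {u v} → u ≡H v → x ∷ u ≡H x ∷ v
≡H-∷ x = ≡H-++ˡ [ x ]

≡H-setoid : Setoid _ _
≡H-setoid = record
  { Carrier       = Word
  ; _≈_           = _≡H_
  ; isEquivalence = record { refl = H-refl ; sym = H-sym ; trans = H-trans }
  }

module ≡H-Reasoning = Relation.Binary.Reasoning.Setoid ≡H-setoid

Distant : ℕ → ℕ → Set
Distant x y = 2 + x ≤ y ⊎ 2 + y ≤ x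

commute : ∀ {x y} w → Distant x y → x ∷ y ∷ w ≡H y ∷ x ∷ w
commute {x} {y} w (inj₁ x≪y) = H-comm [] w x y x≪y
commute {x} {y} w (inj₂ y≪x) = H-sym (H-comm [] w y x y≪x)

slide : ∀ {x} L s → All (Distant x) L → x ∷ L ++ s ≡H L ++ x ∷ s
slide []      s []       = H-refl
slide (y ∷ L) s (d ∷ ds) = H-trans (commute (L ++ s) d) (≡H-∷ y (slide L s ds))

slide-end : ∀ {x} L → All (Distant x) L → x ∷ L ≡H L ++ [ x ]
slide-end {x} L ds = subst (λ w → x ∷ w ≡H L ++ [ x ]) (++-identityʳ L) (slide L [] ds)

distant-above : ∀ {x m} A → x < m → All (m <_) A → All (Distant x) A
distant-above A x<m = All.map (λ m<a → inj₁ (≤-trans (s≤s x<m) m<a))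

distant-below : ∀ {y m} B → y < m → All (_< y) B → All (Distant m) B
distant-below B y<m = All.map (λ b<y → inj₂ (≤-trans (s≤s b<y) y<m))

braid-across : ∀ {k} A B → All (suc k <_) A → All (_< k) B →
  k ∷ A ++ suc k ∷ k ∷ B ≡H (A ++ suc k ∷ k ∷ B) ++ [ suc k ]
braid-across {k} A B A>k+1 B<k = begin
  k ∷ A ++ suc k ∷ k ∷ B           ≈⟨ slide A _ (distant-above A ≤-refl A>k+1) ⟩
  A ++ k ∷ suc k ∷ k ∷ B           ≈⟨ H-braid A B k ⟩
  A ++ suc k ∷ k ∷ suc k ∷ B       ≈⟨ ≡H-++ˡ A (≡H-∷ (suc k) (≡H-∷ k k+1∷B≈B++k+1)) ⟩
  A ++ suc k ∷ k ∷ B ++ [ suc k ]  ≡⟨ sym (++-assoc A _ [ suc k ]) ⟩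
  (A ++ suc k ∷ k ∷ B) ++ [ suc k ] ∎
  where
  open ≡H-Reasoning
  k+1∷B≈B++k+1 = slide-end B (distant-below B ≤-refl B<k)

replace-across : ∀ {x m} A B → x < m → All (m <_) A → All (_< x) B →
  x ∷ A ++ m ∷ B ≡H (A ++ x ∷ B) ++ [ m ]
replace-across {x} {m} A B x<m A>m B<x = begin
  x ∷ A ++ m ∷ B       ≈⟨ slide A _ (distant-above A x<m A>m) ⟩
  A ++ x ∷ m ∷ B       ≈⟨ ≡H-++ˡ A (≡H-∷ x (slide-end B (distant-below B x<m B<x))) ⟩
  A ++ x ∷ B ++ [ m ]  ≡⟨ sym (++-assoc A _ [ m ]) ⟩
  (A ++ x ∷ B) ++ [ m ] ∎
  where open ≡H-Reasoning

absorb-left : ∀ {y} C D → All (λ c → 2 + y ≤ c) C → y ∷ C ++ y ∷ D ≡H C ++ y ∷ D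
absorb-left {y} C D C≫y = begin
  y ∷ C ++ y ∷ D  ≈⟨ slide C _ (All.map inj₁ C≫y) ⟩
  C ++ y ∷ y ∷ D  ≈⟨ H-idem C D y ⟩
  C ++ y ∷ D      ∎
  where open ≡H-Reasoning

absorb-right : ∀ {m} A B → All (λ b → 2 + b ≤ m) B → (A ++ m ∷ B) ++ [ m ] ≡H A ++ m ∷ B
absorb-right {m} A B B≪m = begin
  (A ++ m ∷ B) ++ [ m ]  ≡⟨ ++-assoc A _ [ m ] ⟩
  A ++ m ∷ B ++ [ m ]    ≈⟨ ≡H-++ˡ A (≡H-∷ m (H-sym (slide-end B (All.map inj₂ B≪m)))) ⟩
  A ++ m ∷ m ∷ B         ≈⟨ H-idem A B m ⟩
  A ++ m ∷ B             ∎
  where open ≡H-Reasoning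

Absorbs : Word → ℕ → Set
Absorbs W x = W ++ [ x ] ≡H W

shift : ∀ {V W} p {u q} → V ≡H W ++ p → p ++ u ≡H q → V ++ u ≡H W ++ q
shift {V} {W} p {u} {q} V≈Wp pu≈q = begin
  V ++ u         ≈⟨ ≡H-++ʳ u V≈Wp ⟩
  (W ++ p) ++ u  ≡⟨ ++-assoc W p u ⟩
  W ++ p ++ u    ≈⟨ ≡H-++ˡ W pu≈q ⟩
  W ++ q         ∎
  where open ≡H-Reasoning

carry : ∀ {V W} p {u u′ m} → V ≡H W ++ p → p ++ u ≡H u′ ++ [ m ] → V ++ u ≡H (W ++ u′) ++ [ m ]
carry {W = W} p {u′ = u′} {m} V≈Wp pu≈u′m =
  subst (_ ≡H_) (sym (++-assoc W u′ [ m ])) (shift p V≈Wp pu≈u′m)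

absorbs-++ : ∀ W {u m} → u ++ [ m ] ≡H u → Absorbs (W ++ u) m
absorbs-++ W {u} {m} um≈u = subst (_≡H W ++ u) (sym (++-assoc W u [ m ])) (≡H-++ˡ W um≈u)

Decreasing : List ℕ → Set
Decreasing = AllPairs _>_

record Split (u : List ℕ) (m : ℕ) : Set where
  field
    A B          : List ℕ
    u≡A++m∷B     : u ≡ A ++ m ∷ B
    A>m          : All (m <_) A
    B<m          : All (_< m) B
    B-decreasing : Decreasing B

  ∈B⇒∈u : ∀ {y} → y ∈ B → y ∈ u
  ∈B⇒∈u y∈B = subst (_ ∈_) (sym u≡A++m∷B) (∈-++⁺ʳ A (there y∈B))

  ∈u⇒∈B : ∀ {y} → y ∈ u → y < m → y ∈ B
  ∈u⇒∈B y∈u y<m with ∈-++⁻ A (subst (_ ∈_) u≡A++m∷B y∈u)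
  ... | inj₁ y∈A         = contradiction (All.lookup A>m y∈A) (<-asym y<m)
  ... | inj₂ (here refl) = contradiction y<m (<-irrefl refl)
  ... | inj₂ (there y∈B) = y∈B

split : ∀ {u m} → Decreasing u → m ∈ u → Split u m
split {x ∷ u} (x>u ∷ u↓) (here refl) = record
  { A = [] ; B = u ; u≡A++m∷B = refl ; A>m = [] ; B<m = x>u ; B-decreasing = u↓ }
split {x ∷ u} (x>u ∷ u↓) (there m∈u) = record
  { A = x ∷ A ; B = B ; u≡A++m∷B = cong (x ∷_) u≡A++m∷B
  ; A>m = All.lookup x>u m∈u ∷ A>m ; B<m = B<m ; B-decreasing = B-decreasing }
  where open Split (split u↓ m∈u)

head-of-maximum : ∀ {B y} → Decreasing B → y ∈ B → All (_≤ y) B →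
  ∃ λ B′ → B ≡ y ∷ B′ × All (_< y) B′
head-of-maximum {b ∷ B} (b>B ∷ _) (here refl) _         = B , refl , b>B
head-of-maximum {b ∷ B} (b>B ∷ _) (there y∈B) (b≤y ∷ _) = contradiction b≤y (<⇒≱ (All.lookup b>B y∈B))

braid-row : ∀ {u k} → Decreasing u → suc k ∈ u → k ∈ u → k ∷ u ≡H u ++ [ suc k ]
braid-row {u} {k} u↓ k+1∈u k∈u =
  subst (λ w → k ∷ w ≡H w ++ [ suc k ]) (sym u≡A++k+1∷k∷B′) (braid-across A B′ A>m B′<k)
  where
  open Split (split u↓ k+1∈u)
  B≡k∷B′ = head-of-maximum B-decreasing (∈u⇒∈B k∈u ≤-refl) (All.map s≤s⁻¹ B<m)
  B′ = proj₁ B≡k∷B′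
  B′<k = proj₂ (proj₂ B≡k∷B′)
  u≡A++k+1∷k∷B′ : u ≡ A ++ suc k ∷ k ∷ B′
  u≡A++k+1∷k∷B′ = trans u≡A++m∷B (cong (λ w → A ++ suc k ∷ w) (proj₁ (proj₂ B≡k∷B′)))

absorb-entry-right : ∀ {u m} → Decreasing u → m ∈ u → (∀ {b} → b ∈ u → suc b ≢ m) → u ++ [ m ] ≡H u
absorb-entry-right {u} {m} u↓ m∈u no-pred =
  subst (λ w → w ++ [ m ] ≡H w) (sym u≡A++m∷B) (absorb-right A B B≪m)
  where
  open Split (split u↓ m∈u)
  B≪m : All (λ b → 2 + b ≤ m) B
  B≪m = All.tabulate λ b∈B → ≤∧≢⇒< (All.lookup B<m b∈B) (no-pred (∈B⇒∈u b∈B))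

absorb-entry-left : ∀ {u y} → Decreasing u → y ∈ u → suc y ∉ u → y ∷ u ≡H u
absorb-entry-left {u} {y} u↓ y∈u y+1∉u =
  subst (λ w → y ∷ w ≡H w) (sym u≡A++m∷B) (absorb-left A B A≫y)
  where
  open Split (split u↓ y∈u)
  A≫y : All (λ a → 2 + y ≤ a) A
  A≫y = All.tabulate λ a∈A → ≤∧≢⇒< (All.lookup A>m a∈A) λ { refl → y+1∉u (a∈u a∈A) }
    where
    a∈u : ∀ {a} → a ∈ A → a ∈ u
    a∈u a∈A = subst (_ ∈_) (sym u≡A++m∷B) (∈-++⁺ˡ a∈A)

replaceIn-absent : ∀ {m x} L → All (_≢ m) L → replaceIn m x L ≡ L
replaceIn-absent []      []            = refl
replaceIn-absent {m} (y ∷ L) (y≢m ∷ L≢m) with y ≡ᵇ m | proof (y ≟ m)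
... | true  | ofʸ y≡m = contradiction y≡m y≢m
... | false | _       = cong (y ∷_) (replaceIn-absent L L≢m)

replaceIn-split : ∀ {m x} A B → All (m <_) A → All (_< m) B → replaceIn m x (A ++ m ∷ B) ≡ A ++ x ∷ B
replaceIn-split {m} {x} (a ∷ A) B (m<a ∷ A>m) B<m with a ≡ᵇ m | proof (a ≟ m)
... | true  | ofʸ refl = contradiction m<a (<-irrefl refl)
... | false | _        = cong (a ∷_) (replaceIn-split A B A>m B<m)
replaceIn-split {m} {x} [] B [] B<m with m ≡ᵇ m | proof (m ≟ m)
... | true  | _       = cong (x ∷_) (replaceIn-absent B (All.map (λ b<m → <⇒≢ b<m) B<m))
... | false | ofⁿ m≢m = contradiction refl m≢m

decreasing-replace : ∀ {m x} A B → Decreasing (A ++ m ∷ B) → x < m → All (_< x) B → Decreasing (A ++ x ∷ B)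
decreasing-replace []      B (_ ∷ B↓) x<m B<x = B<x ∷ B↓
decreasing-replace (a ∷ A) B (a>rest ∷ rest↓) x<m B<x with All.++⁻ A a>rest
... | a>A , m<a ∷ a>B = All.++⁺ a>A (<-trans x<m m<a ∷ a>B) ∷ decreasing-replace A B rest↓ x<m B<x

module _ {u m x} (u↓ : Decreasing u) (m∈u : m ∈ u) (x<m : x < m)
         (clear : ∀ {b} → b ∈ u → b < m → b < x) where
  open Split (split u↓ m∈u)

  private
    B<x : All (_< x) B
    B<x = All.tabulate λ b∈B → clear (∈B⇒∈u b∈B) (All.lookup B<m b∈B)

    replaced : replaceIn m x u ≡ A ++ x ∷ B
    replaced = trans (cong (replaceIn m x) u≡A++m∷B) (replaceIn-split A B A>m B<m)

  replace-row : x ∷ u ≡H replaceIn m x u ++ [ m ]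
  replace-row = begin
    x ∷ u                    ≡⟨ cong (x ∷_) u≡A++m∷B ⟩
    x ∷ A ++ m ∷ B           ≈⟨ replace-across A B x<m A>m B<x ⟩
    (A ++ x ∷ B) ++ [ m ]    ≡⟨ cong (_++ [ m ]) (sym replaced) ⟩
    replaceIn m x u ++ [ m ] ∎
    where open ≡H-Reasoning

  replace-decreasing : Decreasing (replaceIn m x u)
  replace-decreasing = subst Decreasing (sym replaced)
    (decreasing-replace A B (subst Decreasing u≡A++m∷B u↓) x<m B<x)

record LeastAbove (u : List ℕ) (y m : ℕ) : Set where
  field
    member : m ∈ u
    above  : y < m
    least  : ∀ {b} → b ∈ u → y < b → m ≤ b

  below-≤ : ∀ {b} → b ∈ u → b < m → b ≤ y
  below-≤ b∈u b<m = ≮⇒≥ λ y<b → <⇒≱ b<m (least b∈u y<b)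

  below-< : y ∉ u → ∀ {b} → b ∈ u → b < m → b < y
  below-< y∉u b∈u b<m = ≤∧≢⇒< (below-≤ b∈u b<m) λ { refl → y∉u b∈u }

leastAbove-pred : ∀ {u y k} → LeastAbove u y (suc k) → k ∈ u → y ≡ k
leastAbove-pred m-least k∈u = ≤-antisym (s≤s⁻¹ above) (below-≤ k∈u ≤-refl)
  where open LeastAbove m-least

leastAbove-succ : ∀ {u y k} → LeastAbove u y (suc k) → k ∉ u → y ∈ u → suc y ∉ u
leastAbove-succ m-least k∉u y∈u y+1∈u =
  k∉u (subst (_∈ _) (≤-antisym (s≤s⁻¹ above) (s≤s⁻¹ (least y+1∈u ≤-refl))) y∈u)
  where open LeastAbove m-least

SmallestAbove : List ℕ → ℕ → Maybe ℕ → Set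
SmallestAbove u y (just m) = LeastAbove u y m
SmallestAbove u y nothing  = ∀ {b} → b ∈ u → ¬ y < b

smallestAbove-spec : ∀ u y → SmallestAbove u y (smallestAbove u y)
smallestAbove-spec []      y = λ ()
smallestAbove-spec (b ∷ u) y with smallestAbove u y | smallestAbove-spec u y
... | just m | m-least with y <ᵇ b | <ᵇ-reflects-< y b
...   | false | ofⁿ y≮b = record
  { member = there member ; above = above
  ; least  = λ { (here refl) y<b → contradiction y<b y≮b ; (there c∈u) → least c∈u } }
  where open LeastAbove m-least
...   | true  | ofʸ y<b with b <ᵇ m | <ᵇ-reflects-< b m
...     | true  | ofʸ b<m = record
  { member = here refl ; above = y<b
  ; least  = λ { (here refl) _ → ≤-refl ; (there c∈u) y<c → ≤-trans (<⇒≤ b<m) (least c∈u y<c) } }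
  where open LeastAbove m-least
...     | false | ofⁿ b≮m = record
  { member = there member ; above = above
  ; least  = λ { (here refl) _ → ≮⇒≥ b≮m ; (there c∈u) → least c∈u } }
  where open LeastAbove m-least
smallestAbove-spec (b ∷ u) y | nothing | none with y <ᵇ b | <ᵇ-reflects-< y b
... | true  | ofʸ y<b = record
  { member = here refl ; above = y<b
  ; least  = λ { (here refl) _ → ≤-refl ; (there c∈u) y<c → contradiction y<c (none c∈u) } }
... | false | ofⁿ y≮b = λ { (here refl) → y≮b ; (there c∈u) → none c∈u }

leastAbove-smallestAbove : ∀ {u y b} → b ∈ u → y < b → LeastAbove u y (fromMaybe0 (smallestAbove u y))
leastAbove-smallestAbove {u} {y} b∈u y<b with smallestAbove u y | smallestAbove-spec u y
... | just m  | m-least = m-least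
... | nothing | none    = contradiction y<b (none b∈u)

last-entry-minimal : ∀ x u → Decreasing (x ∷ u) →
  nth (x ∷ u) (length (x ∷ u)) ∈ x ∷ u × (∀ {b} → b ∈ x ∷ u → nth (x ∷ u) (length (x ∷ u)) ≤ b)
last-entry-minimal x []      _ = here refl , λ { (here refl) → ≤-refl }
last-entry-minimal x (y ∷ u) (x>yu ∷ yu↓) with last-entry-minimal y u yu↓
... | z∈yu , z≤yu = there z∈yu , λ { (here refl) → <⇒≤ (All.lookup x>yu z∈yu) ; (there b∈yu) → z≤yu b∈yu }

last-entry-least : ∀ {u c} → Decreasing u → All (0 <_) u → length u ≡ c → 1 ≤ c → LeastAbove u 0 (nth u c)
last-entry-least {x ∷ u} u↓ u>0 refl _ = record
  { member = proj₁ minimal ; above = All.lookup u>0 (proj₁ minimal) ; least = λ b∈u _ → proj₂ minimal b∈u }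
  where minimal = last-entry-minimal x u u↓

init-last : ∀ {u c} → length u ≡ c → 1 ≤ c → u ≡ take (c ∸ 1) u ++ [ nth u c ]
init-last {x ∷ u} refl _ = go x u
  where
  go : ∀ x u → x ∷ u ≡ take (length u) (x ∷ u) ++ [ nth (x ∷ u) (suc (length u)) ]
  go x []      = refl
  go x (y ∷ u) = cong (x ∷_) (go y u)

memb-reflects : ∀ x u → Reflects (x ∈ u) (memb x u)
memb-reflects x []      = ofⁿ λ ()
memb-reflects x (y ∷ u) with x ≡ᵇ y | proof (x ≟ y)
... | true  | ofʸ refl = ofʸ (here refl)
... | false | ofⁿ x≢y with memb x u | memb-reflects x u
...   | true  | ofʸ x∈u = ofʸ (there x∈u)
...   | false | ofⁿ x∉u = ofⁿ λ { (here x≡y) → x≢y x≡y ; (there x∈u) → x∉u x∈u }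

memb-true : ∀ {x u} → memb x u ≡ true → x ∈ u
memb-true {x} {u} eq = invert (subst (Reflects (x ∈ u)) eq (memb-reflects x u))

memb-false : ∀ {x u} → memb x u ≡ false → x ∉ u
memb-false {x} {u} eq = invert (subst (Reflects (x ∈ u)) eq (memb-reflects x u))

rowWord-∷ : ∀ u T → rowWord (u ∷ T) ≡ rowWord T ++ u
rowWord-∷ u T = begin
  concat (reverse (u ∷ T))     ≡⟨ cong concat (unfold-reverse u T) ⟩
  concat (reverse T ++ [ u ])  ≡⟨ concat-++ (reverse T) [ u ] ⟨
  rowWord T ++ u ++ []         ≡⟨ cong (rowWord T ++_) (++-identityʳ u) ⟩
  rowWord T ++ u               ∎
  where open ≡-Reasoning

ejectable⇒absorbs : ∀ T x → All Decreasing T → ejectable T x ≡ true → Absorbs (rowWord T) x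
-- For x = 0 (where 0 ∸ 1 = 0) the ejection chain is vacuous: 0 is absorbed by its own row.
ejectable⇒absorbs (u ∷ T) zero (u↓ ∷ _) ej with memb 0 u | memb-reflects 0 u
... | true | ofʸ 0∈u =
  subst (λ w → Absorbs w 0) (sym (rowWord-∷ u T)) (absorbs-++ (rowWord T) (absorb-entry-right u↓ 0∈u λ _ ()))
ejectable⇒absorbs (u ∷ T) (suc k) (u↓ ∷ T↓) ej
  with memb (suc k) u | memb-reflects (suc k) u | memb k u | memb-reflects k u
... | true | ofʸ k+1∈u | false | ofⁿ k∉u =
  subst (λ w → Absorbs w (suc k)) (sym (rowWord-∷ u T))
    (absorbs-++ (rowWord T) (absorb-entry-right u↓ k+1∈u λ { b∈u refl → k∉u b∈u }))
... | true | ofʸ k+1∈u | true | ofʸ k∈u =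
  subst (λ w → Absorbs w (suc k)) (sym (rowWord-∷ u T))
    (H-sym (carry [ k ] (H-sym (ejectable⇒absorbs T k T↓ ej)) (braid-row u↓ k+1∈u k∈u)))

modifyRow-++ : ∀ {j} f xs u Q → length xs ≡ j → modifyRow (suc j) f (xs ++ u ∷ Q) ≡ xs ++ f u ∷ Q
modifyRow-++ f []       u Q refl = refl
modifyRow-++ f (x ∷ xs) u Q refl = cong (x ∷_) (modifyRow-++ f xs u Q refl)

dropRows-++ : ∀ {j} xs (u : List ℕ) Q → length xs ≡ j → dropRows (suc j) (xs ++ u ∷ Q) ≡ Q
dropRows-++ []       u Q refl = refl
dropRows-++ (x ∷ xs) u Q refl = dropRows-++ xs u Q refl

rowAt-All : ∀ {Q : List ℕ → Set} {P} → Q [] → All Q P → ∀ i → Q (rowAt P i)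
rowAt-All Q[] []           i             = Q[]
rowAt-All Q[] (_ ∷ _)      zero          = Q[]
rowAt-All Q[] (Qu ∷ _)     (suc zero)    = Qu
rowAt-All Q[] (_ ∷ QP)     (suc (suc i)) = rowAt-All Q[] QP (suc i)

dropRows-All : ∀ {Q : List ℕ → Set} {P} j → All Q P → All Q (dropRows j P)
dropRows-All zero    QP        = QP
dropRows-All (suc j) []        = []
dropRows-All (suc j) (_ ∷ QP)  = dropRows-All j QP

rowAt-Below : ∀ {P} → Linked Below P → ∀ i → Below (rowAt P (suc i)) (rowAt P (suc (suc i)))
rowAt-Below []            _       = _
rowAt-Below [-]           _       = _
rowAt-Below (u≻v ∷ _)     zero    = u≻v
rowAt-Below (_ ∷ columns) (suc i) = rowAt-Below columns i

Below⇒∃> : ∀ {u w y} → Below u w → y ∈ w → ∃ λ z → z ∈ u × y < z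
Below⇒∃> {a ∷ u} {b ∷ w} (b<a , _) (here refl) = a , here refl , b<a
Below⇒∃> {a ∷ u} {b ∷ w} (_ , w≺u) (there y∈w) = Product.map₂ (Product.map₁ there) (Below⇒∃> w≺u y∈w)

dropRows-suc : ∀ j P → suc j ≤ length P → dropRows j P ≡ rowAt P (suc j) ∷ dropRows (suc j) P
dropRows-suc zero    (u ∷ P) _         = refl
dropRows-suc (suc j) (u ∷ P) (s≤s j<n) = dropRows-suc j P j<n

take-suc : ∀ j P → suc j ≤ length P → take (suc j) P ≡ take j P ++ [ rowAt P (suc j) ]
take-suc zero    (u ∷ P) _         = refl
take-suc (suc j) (u ∷ P) (s≤s j<n) = cong (u ∷_) (take-suc j P j<n)

split-at-row : ∀ j P → suc j ≤ length P → P ≡ take j P ++ rowAt P (suc j) ∷ dropRows (suc j) P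
split-at-row zero    (u ∷ P) _         = refl
split-at-row (suc j) (u ∷ P) (s≤s j<n) = cong (u ∷_) (split-at-row j P j<n)

length-take-≤ : ∀ j (P : Tab) → j ≤ length P → length (take j P) ≡ j
length-take-≤ j P j≤n = trans (length-take j P) (m≤n⇒m⊓n≡m j≤n)

-- The disjunct y ≡ 0 covers the start of the α = 0 run, where m_{r+1} = 0.
Inv : Word → Word → ℕ → Bool → Set
Inv V W y true  = V ≡H W ++ [ y ]
Inv V W y false = V ≡H W × (y ≡ 0 ⊎ Absorbs W y)

Inv⇒≡H : ∀ {V W m} a → Inv V W m a → 0 < m → V ≡H W ++ [ m ]
Inv⇒≡H true  V≈Wm                     _   = V≈Wm
Inv⇒≡H false (V≈W , inj₁ refl)        ()
Inv⇒≡H false (V≈W , inj₂ W-absorbs-m) _   = H-trans V≈W (H-sym W-absorbs-m)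

∧-not≡true : ∀ a b → (a ∧ not b) ≡ true → a ≡ true × b ≡ false
∧-not≡true true false _ = refl , refl

∧-not≡false : ∀ a b → (a ∧ not b) ≡ false → a ≡ true → b ≡ true
∧-not≡false true true _ _ = refl

firstWith-just : ∀ p L {x} → firstWith p L ≡ just x → x ∈ L × p x ≡ true
firstWith-just p (y ∷ L) found with p y in py
... | true  with found
...   | refl = here refl , py
firstWith-just p (y ∷ L) found | false = Product.map₁ there (firstWith-just p L found)

candidates-between : ∀ {y m x} → y < m → x ∈ map (λ i → suc y + i) (upTo (m ∸ suc y)) → y < x × x < m
candidates-between {y} y<m x∈ with ∈-map⁻ (λ i → suc y + i) x∈
... | i , i∈ , refl = m≤m+n (suc y) i , subst (suc y + i <_) (m+[n∸m]≡n y<m) (+-monoʳ-< (suc y) (∈-upTo⁻ i∈))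

D-preserves-Inv : ∀ {u k y a V W} → Decreasing u → All (0 <_) u → LeastAbove u y (suc k) → k ∈ u →
  Inv V W y a → Inv (V ++ u) (W ++ u) (suc k) a
D-preserves-Inv {u} {k} {a = a} {V} {W} u↓ u>0 m-least k∈u inv with leastAbove-pred m-least k∈u
... | refl = lift a inv
  where
  row : k ∷ u ≡H u ++ [ suc k ]
  row = braid-row u↓ (LeastAbove.member m-least) k∈u
  lift : ∀ a → Inv V W k a → Inv (V ++ u) (W ++ u) (suc k) a
  lift true  V≈Wk                     = carry [ k ] V≈Wk row
  lift false (V≈W , inj₁ k≡0)         = contradiction (subst (0 <_) k≡0 (All.lookup u>0 k∈u)) (<-irrefl refl)
  lift false (V≈W , inj₂ W-absorbs-k) =
    ≡H-++ʳ u V≈W , inj₂ (H-sym (carry [ k ] (H-sym W-absorbs-k) row))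

pending-absorbed : ∀ {u k y} a {V W} → Decreasing u → LeastAbove u y (suc k) → k ∉ u →
  (a ∧ not (memb y u)) ≡ false → Inv V W y a → V ++ u ≡H W ++ u
pending-absorbed {u} true u↓ m-least k∉u y-pending V≈Wy =
  shift [ _ ] V≈Wy (absorb-entry-left u↓ y∈u (leastAbove-succ m-least k∉u y∈u))
  where y∈u = memb-true (∧-not≡false true (memb _ u) y-pending refl)
pending-absorbed {u} false _ _ _ _ (V≈W , _) = ≡H-++ʳ u V≈W

processRow-preserves-Inv : ∀ {P P′ j xs Q mi y a V} →
  length xs ≡ j → P′ ≡ xs ++ rowAt P (suc j) ∷ Q → All Decreasing Q →
  Decreasing (rowAt P (suc j)) → All (0 <_) (rowAt P (suc j)) → LeastAbove (rowAt P (suc j)) y mi →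
  Inv V (rowWord Q) y a →
  ∃ λ u′ → proj₁ (processRow P P′ (suc j) mi y a) ≡ xs ++ u′ ∷ Q × Decreasing u′
         × Inv (V ++ rowAt P (suc j)) (rowWord Q ++ u′) mi (proj₂ (processRow P P′ (suc j) mi y a))
processRow-preserves-Inv {mi = zero} _ _ _ _ _ m-least _ = contradiction (LeastAbove.above m-least) n≮0
processRow-preserves-Inv {P} {P′} {j} {xs} {Q} {suc k} {y} {a} len P′≡ Q↓ u↓ u>0 m-least inv
  with memb k (rowAt P (suc j)) | memb-reflects k (rowAt P (suc j))
... | true  | ofʸ k∈u = rowAt P (suc j) , P′≡ , u↓ , D-preserves-Inv u↓ u>0 m-least k∈u inv
... | false | ofⁿ k∉u with a ∧ not (memb y (rowAt P (suc j))) in pending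
...   | true with ∧-not≡true a _ pending
...     | refl , y-absent =
  replaceIn (suc k) y (rowAt P (suc j)) , trans (cong (modifyRow (suc j) _) P′≡) (modifyRow-++ _ xs _ Q len) ,
  replace-decreasing u↓ member above clear , carry [ y ] inv (replace-row u↓ member above clear)
  where
  open LeastAbove m-least
  clear = below-< (memb-false y-absent)
processRow-preserves-Inv {P} {P′} {j} {xs} {Q} {suc k} {y} {a} len P′≡ Q↓ u↓ u>0 m-least inv | false | ofⁿ k∉u | false
  with firstWith (ejectable (dropRows (suc j) P′)) (map (λ i → suc y + i) (upTo (suc k ∸ suc y))) in found
... | just x =
  replaceIn (suc k) x (rowAt P (suc j)) , trans (cong (modifyRow (suc j) _) P′≡) (modifyRow-++ _ xs _ Q len) ,
  replace-decreasing u↓ member x<m clear ,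
  H-trans (pending-absorbed a u↓ m-least k∉u pending inv)
          (carry [ x ] (H-sym W-absorbs-x) (replace-row u↓ member x<m clear))
  where
  open LeastAbove m-least
  x-ejectable = firstWith-just _ _ found
  y<x = proj₁ (candidates-between above (proj₁ x-ejectable))
  x<m = proj₂ (candidates-between above (proj₁ x-ejectable))
  clear : ∀ {b} → b ∈ rowAt P (suc j) → b < suc k → b < x
  clear b∈u b<m = ≤-<-trans (below-≤ b∈u b<m) y<x
  W-absorbs-x : Absorbs (rowWord Q) x
  W-absorbs-x = ejectable⇒absorbs Q x Q↓
    (subst (λ T → ejectable T x ≡ true) (trans (cong (dropRows (suc j)) P′≡) (dropRows-++ xs _ Q len))
           (proj₂ x-ejectable))
... | nothing =
  rowAt P (suc j) , P′≡ , u↓ , pending-absorbed a u↓ m-least k∉u pending inv ,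
  inj₂ (absorbs-++ (rowWord Q) (absorb-entry-right u↓ (LeastAbove.member m-least) λ { b∈u refl → k∉u b∈u }))

module ReverseInsertion (P : Tab) (r c : ℕ)
  (rows↓ : All Decreasing P) (rows>0 : All (All (0 <_)) P) (columns : Linked Below P)
  (row-length : length (rowAt P r) ≡ c) (c≥1 : 1 ≤ c) (r≤length : r ≤ length P) where

  m : ℕ → ℕ
  m = bumpPath P r c

  row↓ : ∀ i → Decreasing (rowAt P i)
  row↓ = rowAt-All [] rows↓

  row>0 : ∀ i → All (0 <_) (rowAt P i)
  row>0 = rowAt-All [] rows>0

  m-bottom : m r ≡ nth (rowAt P r) c
  m-bottom = cong (pathAux P r c) (n∸n≡0 r)

  bottom-leastAbove : LeastAbove (rowAt P r) 0 (m r)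
  bottom-leastAbove =
    subst (LeastAbove (rowAt P r) 0) (sym m-bottom) (last-entry-least (row↓ r) (row>0 r) row-length c≥1)

  m-suc : ∀ {i} → i < r → m i ≡ fromMaybe0 (smallestAbove (rowAt P i) (m (suc i)))
  m-suc {i} i<r = begin
    pathAux P r c (r ∸ i)                                    ≡⟨ cong (pathAux P r c) r-i≡1+[r-1-i] ⟩
    fromMaybe0 (smallestAbove (rowAt P (r ∸ suc (r ∸ suc i))) (m (suc i)))
      ≡⟨ cong (λ t → fromMaybe0 (smallestAbove (rowAt P t) (m (suc i))))
              (trans (cong (r ∸_) (sym r-i≡1+[r-1-i])) (m∸[m∸n]≡n (<⇒≤ i<r))) ⟩
    fromMaybe0 (smallestAbove (rowAt P i) (m (suc i)))       ∎
    where
    open ≡-Reasoning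
    r-i≡1+[r-1-i] : r ∸ i ≡ suc (r ∸ suc i)
    r-i≡1+[r-1-i] = +-∸-assoc 1 i<r

  mutual
    bumpPath-∈ : ∀ d i → suc i + d ≡ r → m (suc i) ∈ rowAt P (suc i)
    bumpPath-∈ zero    i i+1≡r =
      subst (λ t → m t ∈ rowAt P t) (trans (sym i+1≡r) (+-identityʳ (suc i))) (LeastAbove.member bottom-leastAbove)
    bumpPath-∈ (suc d) i i+d+2≡r = LeastAbove.member (bumpPath-leastAbove d i i+d+2≡r)

    bumpPath-leastAbove : ∀ d i → suc i + suc d ≡ r →
      LeastAbove (rowAt P (suc i)) (m (suc (suc i))) (m (suc i))
    bumpPath-leastAbove d i i+d+2≡r
      with Below⇒∃> (rowAt-Below columns i) (bumpPath-∈ d (suc i) (trans (sym (+-suc (suc i) d)) i+d+2≡r))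
    ... | b , b∈u , m<b =
      subst (LeastAbove (rowAt P (suc i)) (m (suc (suc i)))) (sym (m-suc i+1<r)) (leastAbove-smallestAbove b∈u m<b)
      where
      i+1<r : suc i < r
      i+1<r = subst (suc i <_) i+d+2≡r (m<m+n (suc i) z<s)

  row-leastAbove : ∀ i → suc (suc i) ≤ r → LeastAbove (rowAt P (suc i)) (m (suc (suc i))) (m (suc i))
  row-leastAbove i i+2≤r = bumpPath-leastAbove (r ∸ suc (suc i)) i (trans (+-suc (suc i) _) (m+[n∸m]≡n i+2≤r))

  m₁>0 : 1 ≤ r → 0 < m 1
  m₁>0 1≤r = All.lookup (row>0 1) (bumpPath-∈ (r ∸ 1) 0 (m+[n∸m]≡n 1≤r))

  processRow-at : ∀ j {P′ Q y a} → suc j ≤ r → P′ ≡ take j P ++ rowAt P (suc j) ∷ Q → All Decreasing Q →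
    LeastAbove (rowAt P (suc j)) y (m (suc j)) → Inv (rowWord (dropRows (suc j) P)) (rowWord Q) y a →
    ∃ λ u′ → proj₁ (processRow P P′ (suc j) (m (suc j)) y a) ≡ take j P ++ u′ ∷ Q × Decreasing u′
           × Inv (rowWord (dropRows j P)) (rowWord (u′ ∷ Q)) (m (suc j))
                 (proj₂ (processRow P P′ (suc j) (m (suc j)) y a))
  processRow-at j {P′} {Q} {y} {a} j<r P′≡ Q↓ m-leastAbove inv
    with processRow-preserves-Inv {P = P} (length-take-≤ j P (<⇒≤ j<n)) P′≡ Q↓ (row↓ (suc j)) (row>0 (suc j))
                                  m-leastAbove inv
    where j<n = ≤-trans j<r r≤length
  ... | u′ , P″≡ , u′↓ , inv′ =
    u′ , P″≡ , u′↓ ,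
    subst₂ (λ V W → Inv V W (m (suc j)) (proj₂ (processRow P P′ (suc j) (m (suc j)) y a)))
      (trans (sym (rowWord-∷ (rowAt P (suc j)) (dropRows (suc j) P)))
             (cong rowWord (sym (dropRows-suc j P (≤-trans j<r r≤length)))))
      (sym (rowWord-∷ u′ Q)) inv′

  processRows-sound : ∀ j {P′ Q a} → j < r → P′ ≡ take j P ++ Q → All Decreasing Q →
    Inv (rowWord (dropRows j P)) (rowWord Q) (m (suc j)) a →
    rowWord P ≡H rowWord (processRows P r c j P′ (m (suc j)) a) ++ [ m 1 ]
  processRows-sound zero    {a = a} 0<r refl _  inv = Inv⇒≡H a inv (m₁>0 0<r)
  processRows-sound (suc j) {P′} {Q} j+1<r P′≡ Q↓ inv
    with processRow-at j (<⇒≤ j+1<r) P′-splits Q↓ (row-leastAbove j j+1<r) inv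
    where
    P′-splits : P′ ≡ take j P ++ rowAt P (suc j) ∷ Q
    P′-splits = trans P′≡ (trans (cong (_++ Q) (take-suc j P (≤-trans (<⇒≤ j+1<r) r≤length)))
                            (++-assoc (take j P) _ Q))
  ... | u′ , P″≡ , u′↓ , inv′ = processRows-sound j (<-trans (n<1+n j) j+1<r) P″≡ (u′↓ ∷ Q↓) inv′

Ψ-sound : ∀ P r c α → All Decreasing P → All (All (0 <_)) P → Linked Below P →
  length (rowAt P (suc r)) ≡ c → 1 ≤ c → suc r ≤ length P →
  rowWord P ≡H rowWord (proj₁ (Ψ P (suc r) c α)) ++ [ proj₂ (Ψ P (suc r) c α) ]
Ψ-sound P r c true rows↓ rows>0 columns row-length c≥1 r<n =
  processRows-sound r ≤-refl P′≡ (take⁺ (c ∸ 1) (row↓ (suc r)) ∷ dropRows-All (suc r) rows↓) deleted-pending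
  where
  open ReverseInsertion P (suc r) c rows↓ rows>0 columns row-length c≥1 r<n
  u    = rowAt P (suc r)
  rest = dropRows (suc r) P
  P′≡ : modifyRow (suc r) (take (c ∸ 1)) P ≡ take r P ++ take (c ∸ 1) u ∷ rest
  P′≡ = trans (cong (modifyRow (suc r) (take (c ∸ 1))) (split-at-row r P r<n))
              (modifyRow-++ _ (take r P) u rest (length-take-≤ r P (<⇒≤ r<n)))
  deleted-pending : rowWord (dropRows r P) ≡H rowWord (take (c ∸ 1) u ∷ rest) ++ [ m (suc r) ]
  deleted-pending = begin
    rowWord (dropRows r P)                             ≡⟨ cong rowWord (dropRows-suc r P r<n) ⟩
    rowWord (u ∷ rest)                                 ≡⟨ rowWord-∷ u rest ⟩
    rowWord rest ++ u                                  ≡⟨ cong (rowWord rest ++_) (init-last row-length c≥1) ⟩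
    rowWord rest ++ take (c ∸ 1) u ++ [ nth u c ]      ≡⟨ ++-assoc (rowWord rest) _ _ ⟨
    (rowWord rest ++ take (c ∸ 1) u) ++ [ nth u c ]    ≡⟨ cong₂ (λ w z → w ++ [ z ]) (rowWord-∷ _ rest) m-bottom ⟨
    rowWord (take (c ∸ 1) u ∷ rest) ++ [ m (suc r) ]   ∎
    where open ≡H-Reasoning
Ψ-sound P r c false rows↓ rows>0 columns row-length c≥1 r<n
  with processRow-at r ≤-refl (split-at-row r P r<n) (dropRows-All (suc r) rows↓) bottom-leastAbove (H-refl , inj₁ refl)
  where open ReverseInsertion P (suc r) c rows↓ rows>0 columns row-length c≥1 r<n
... | u′ , P″≡ , u′↓ , inv =
  processRows-sound r ≤-refl P″≡ (u′↓ ∷ dropRows-All (suc r) rows↓) inv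
  where open ReverseInsertion P (suc r) c rows↓ rows>0 columns row-length c≥1 r<n

lemma3p3 : (P : Tab) (r c : ℕ) (α : Bool) →
    DecreasingTableau P → Removable P r c →
    rowWord P ≡H (rowWord (proj₁ (Ψ P r c α)) ++ [ proj₂ (Ψ P r c α) ])
lemma3p3 P zero    c α _ (() , _)
lemma3p3 P (suc r) c α (_ , rows>0 , rows , columns) (_ , r<n , c≥1 , row-length , _) =
  Ψ-sound P r c α (All.map (Linked⇒AllPairs (λ y<x z<y → <-trans z<y y<x)) rows) rows>0 columns row-length c≥1 r<n
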